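{- Suppose there exists a signature set on a finite group $K_r$ with respect to a normal subgroup $E_r\cong C_2^r$, and there exists a signature set on a finite group $K_s$ with respect to a normal subgroup $E_s\cong C_2^s$. Then there exists a signature set on $K_r\times K_s$ with respect to $E_r\times E_s$.
   Context: For $A=\sum a_g g$ in a group ring $\mathbb{Z}K$, $A^{(-1)}=\sum a_g g^{ -1}$. For a normal subgroup $E=\langle x_1,\dots,x_m\rangle\cong C_2^m$ of a finite group $K$, let $U_m=\mathrm{GF}(2)^m$ and for $u\in U_m$ let $\chi_u=\prod_{i=1}^m(1+(-1)^{u_i}x_i)\in\mathbb{Z}E$ (the characters of $E$). A signature block on $K$ with respect to $\chi_u$ is an element $A_u\in\mathbb{Z}K$ that is $\{\pm1\}$-valued on some set of coset representatives for $E$ in $K$ and zero elsewhere, with $A_u\chi_uA_u^{(-1)}=\frac{|K|}{2^m}\chi_u$. A signature set on $K$ with respect to $E$ is a multiset $\{A_u:u\in U_m\}$ where each $A_u$ is a signature block with respect to $\chi_u$. -}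

module Defs where

open import Level using (0ℓ)
open import Data.Nat as ℕ using (ℕ; zero; suc; _^_)
open import Data.Nat.Properties using (m^n≢0)
open import Data.Integer as ℤ using (ℤ; +_; -_)
open import Data.Bool using (Bool; true; false; if_then_else_)
open import Data.Fin using (Fin; zero; suc; splitAt; remQuot; combine)
open import Data.Fin.Properties using (remQuot-combine; combine-remQuot)
open import Data.Vec using (Vec; []; _∷_; _++_)
open import Data.Sum using ([_,_]′)
open import Data.Product using (Σ; ∃; _×_; _,_; proj₁; proj₂; uncurry)
open import Data.Product.Function.NonDependent.Propositional using (_×-↔_)
open import Function using (_∘_)
open import Function.Bundles using (_↔_; mk↔ₛ′; Inverse)
open import Function.Properties.Inverse using (↔-trans)
open import Relation.Binary.PropositionalEquality
  using (_≡_; _≢_; refl; cong; cong₂; isEquivalence)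
open import Algebra.Structures using (IsGroup)
open import Relation.Nullary using (does)
open import Data.Fin using () renaming (_≟_ to _≟ᶠ_)
open import Data.Sum using (_⊎_)

record FinGroup : Set₁ where
  infixl 7 _∙_
  field
    Carrier : Set
    _∙_     : Carrier → Carrier → Carrier
    ε       : Carrier
    _⁻¹     : Carrier → Carrier
    isGroup : IsGroup _≡_ _∙_ ε _⁻¹
    order   : ℕ
    enum    : Fin order ↔ Carrier

  elt : Fin order → Carrier
  elt = Inverse.to enum

sumFin : (n : ℕ) → (Fin n → ℤ) → ℤ
sumFin zero    f = + 0
sumFin (suc n) f = f zero ℤ.+ sumFin n (f ∘ suc)

-- The integral group ring ℤK (K finite, so elements are all functions K → ℤ)

module GroupRing (K : FinGroup) where
  open FinGroup K

  ℤK : Set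
  ℤK = Carrier → ℤ

  δ : Carrier → ℤK
  δ g h = if does (Inverse.from enum g ≟ᶠ Inverse.from enum h) then + 1 else + 0

  _⊕_ : ℤK → ℤK → ℤK
  (A ⊕ B) g = A g ℤ.+ B g

  _·_ : ℤ → ℤK → ℤK
  (c · A) g = c ℤ.* A g

  _⊛_ : ℤK → ℤK → ℤK
  (A ⊛ B) g = sumFin order (λ i → A (elt i) ℤ.* B ((elt i ⁻¹) ∙ g))

  inv⁽⁻¹⁾ : ℤK → ℤK
  inv⁽⁻¹⁾ A g = A (g ⁻¹)

-- E = ⟨x₁,…,xₘ⟩ with generators x : Fin m → K.  Elements u ∈ U_m = GF(2)^m
-- are Vec Bool m (true = 1).

module Elementary (K : FinGroup) where
  open FinGroup K
  open GroupRing K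

  eE : ∀ {m} → (Fin m → Carrier) → Vec Bool m → Carrier
  eE x []       = ε
  eE x (b ∷ u)  = (if b then x zero else ε) ∙ eE (x ∘ suc) u

  χ : ∀ {m} → (Fin m → Carrier) → Vec Bool m → ℤK
  χ x []      = δ ε
  χ x (b ∷ u) = (δ ε ⊕ ((if b then - (+ 1) else + 1) · δ (x zero))) ⊛ χ (x ∘ suc) u

  record IsElemAbNormal {m : ℕ} (x : Fin m → Carrier) : Set where
    field
      sq-id   : ∀ i → x i ∙ x i ≡ ε
      comm    : ∀ i j → x i ∙ x j ≡ x j ∙ x i
      indep   : ∀ u v → eE x u ≡ eE x v → u ≡ v
      normal  : ∀ g i → ∃ λ u → (g ∙ x i) ∙ (g ⁻¹) ≡ eE x u

  -- A is {±1}-valued on some set of coset representatives of E and zero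
  -- elsewhere: values lie in {0, 1, -1}, and each coset gE contains exactly
  -- one element where A is nonzero.
  IsCosetTransversalSign : ∀ {m} → (Fin m → Carrier) → ℤK → Set
  IsCosetTransversalSign x A =
      (∀ g → (A g ≡ + 0) ⊎ ((A g ≡ + 1) ⊎ (A g ≡ - (+ 1))))
    × (∀ g → Σ (Vec Bool _) λ u → A (g ∙ eE x u) ≢ + 0)
    × (∀ g u v → A (g ∙ eE x u) ≢ + 0 → A (g ∙ eE x v) ≢ + 0 → u ≡ v)

  index : ℕ → ℕ
  index m = ℕ._/_ order (2 ^ m) {{m^n≢0 2 m}}

  IsSignatureBlock : ∀ {m} → (Fin m → Carrier) → Vec Bool m → ℤK → Set
  IsSignatureBlock {m} x u A =
    IsCosetTransversalSign x A
    × (∀ g → ((A ⊛ χ x u) ⊛ inv⁽⁻¹⁾ A) g ≡ ((+ index m) · χ x u) g)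

  SignatureSet : ∀ {m} → (Fin m → Carrier) → Set
  SignatureSet {m} x =
    Σ (Vec Bool m → ℤK) λ A → ∀ u → IsSignatureBlock x u (A u)

_×ᴳ_ : FinGroup → FinGroup → FinGroup
K ×ᴳ L = record
  { Carrier = K.Carrier × L.Carrier
  ; _∙_ = λ a b → (proj₁ a K.∙ proj₁ b) , (proj₂ a L.∙ proj₂ b)
  ; ε = K.ε , L.ε
  ; _⁻¹ = λ a → (proj₁ a K.⁻¹) , (proj₂ a L.⁻¹)
  ; isGroup = record
    { isMonoid = record
      { isSemigroup = record
        { isMagma = record
          { isEquivalence = isEquivalence
          ; ∙-cong = λ { refl refl → refl } }
        ; assoc = λ a b c → cong₂ _,_ (K.assoc _ _ _) (L.assoc _ _ _) }
      ; identity = (λ a → cong₂ _,_ (K.identityˡ _) (L.identityˡ _))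
                 , (λ a → cong₂ _,_ (K.identityʳ _) (L.identityʳ _)) }
    ; inverse = (λ a → cong₂ _,_ (K.inverseˡ _) (L.inverseˡ _))
              , (λ a → cong₂ _,_ (K.inverseʳ _) (L.inverseʳ _))
    ; ⁻¹-cong = λ { refl → refl } }
  ; order = K.order ℕ.* L.order
  ; enum = ↔-trans finProd (K.enum ×-↔ L.enum)
  }
  where
  module K where
    open FinGroup K public
    open IsGroup isGroup public using (assoc; identityˡ; identityʳ; inverseˡ; inverseʳ)
  module L where
    open FinGroup L public
    open IsGroup isGroup public using (assoc; identityˡ; identityʳ; inverseˡ; inverseʳ)
  finProd : Fin (K.order ℕ.* L.order) ↔ (Fin K.order × Fin L.order)
  finProd = mk↔ₛ′ (remQuot L.order) (uncurry combine)
                  (λ p → remQuot-combine (proj₁ p) (proj₂ p))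
                  (combine-remQuot {K.order} L.order)

prodGens : (K L : FinGroup) {r s : ℕ}
         → (Fin r → FinGroup.Carrier K) → (Fin s → FinGroup.Carrier L)
         → Fin (r ℕ.+ s) → FinGroup.Carrier (K ×ᴳ L)
prodGens K L {r} x y i =
  [ (λ j → x j , FinGroup.ε L) , (λ j → FinGroup.ε K , y j) ]′ (splitAt r i)

-- Order the generators of E_r × E_s as (x₁,1),…,(x_r,1),(1,y₁),…,(1,y_s), so that
-- each w ∈ U_{r+s} is u ++ v with u ∈ U_r, v ∈ U_s.  Then χ_{u++v} = χ_u ⊗ χ_v, and convolution on
-- K_r × K_s maps tensor products to tensor products, so A_u ⊗ B_v is ±1 on a
-- transversal of E_r × E_s and (A_u ⊗ B_v) χ_{u++v} (A_u ⊗ B_v)^{(-1)} equals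
-- (|K_r|/2^r)(|K_s|/2^s) χ_{u++v}.  Since index is truncated division, identifying
-- this scalar with |K_r × K_s|/2^{r+s} needs 2^r ∣ |K_r|: a transversal meets each
-- coset of E_r exactly once, so |K_r| = 2^r · Σ_g A_u(g)².

module Submission where

open import Level using (0ℓ)
open import Function using (_∘_)
open import Function.Bundles using (_↔_; Inverse; mk↔ₛ′)
open import Data.Bool using (Bool; true; false; if_then_else_)
open import Data.Sum using (_⊎_; inj₁; inj₂; [_,_]′)
open import Data.Product using (Σ; ∃; _×_; _,_; proj₁; proj₂)
open import Data.Nat as ℕ using (ℕ; zero; suc; _^_; NonZero)
import Data.Nat.Properties as ℕ
open import Data.Nat.Divisibility using (_∣_; divides)
open import Data.Nat.DivMod using (_/_; /-congˡ; /-congʳ; m*n/n≡m; m/n*n≡m)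
open import Data.Integer as ℤ using (ℤ; +_; -_; _+_; _*_)
import Data.Integer.Properties as ℤ
open import Data.Integer.Solver using (module +-*-Solver)
open +-*-Solver using (solve; _:+_; _:*_; _:=_)
open import Data.Fin as Fin using (Fin; zero; suc; _↑ˡ_; _↑ʳ_; combine)
open import Data.Fin.Properties using (punchInᵢ≢i; remQuot-combine) renaming (_≟_ to _≟ᶠ_)
open import Data.Vec using (Vec; []; _∷_; _++_; take; drop; replicate)
open import Data.Vec.Properties using (∷-injectiveʳ; take++drop≡id)
open import Data.Vec.Functional using (removeAt)
open import Relation.Binary.Definitions using (DecidableEquality)
open import Relation.Binary.PropositionalEquality
open import Relation.Nullary using (yes; no; contradiction)
open import Relation.Nullary.Decidable using (map′; dec-true; dec-false)
open import Algebra.Bundles using (Group)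
open import Algebra.Structures using (IsGroup)
import Algebra.Properties.Group as GroupProperties
import Algebra.Properties.Semiring.Sum as SemiringSum
open import Algebra.Properties.CommutativeSemigroup ℤ.*-commutativeSemigroup using (interchange)

open import Defs

module ℤΣ = SemiringSum ℤ.+-*-semiring

sumFin-cong : ∀ n {f g : Fin n → ℤ} → f ≗ g → sumFin n f ≡ sumFin n g
sumFin-cong zero    f≗g = refl
sumFin-cong (suc n) f≗g = cong₂ _+_ (f≗g zero) (sumFin-cong n (f≗g ∘ suc))

sumFin≡sum : ∀ n (f : Fin n → ℤ) → sumFin n f ≡ ℤΣ.sum f
sumFin≡sum zero    f = refl
sumFin≡sum (suc n) f = cong (_+_ (f zero)) (sumFin≡sum n (f ∘ suc))

sumFin-distrib-+ : ∀ n (f g : Fin n → ℤ) →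
                   sumFin n (λ i → f i + g i) ≡ sumFin n f + sumFin n g
sumFin-distrib-+ n f g = begin
  sumFin n (λ i → f i + g i)  ≡⟨ sumFin≡sum n _ ⟩
  ℤΣ.sum (λ i → f i + g i)    ≡⟨ ℤΣ.∑-distrib-+ f g ⟩
  ℤΣ.sum f + ℤΣ.sum g         ≡⟨ cong₂ _+_ (sumFin≡sum n f) (sumFin≡sum n g) ⟨
  sumFin n f + sumFin n g     ∎
  where open ≡-Reasoning

*-distribˡ-sumFin : ∀ n c (f : Fin n → ℤ) → c * sumFin n f ≡ sumFin n (λ i → c * f i)
*-distribˡ-sumFin n c f = begin
  c * sumFin n f              ≡⟨ cong (c *_) (sumFin≡sum n f) ⟩
  c * ℤΣ.sum f                ≡⟨ ℤΣ.*-distribˡ-sum c f ⟩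
  ℤΣ.sum (λ i → c * f i)      ≡⟨ sumFin≡sum n _ ⟨
  sumFin n (λ i → c * f i)    ∎
  where open ≡-Reasoning

*-distribʳ-sumFin : ∀ n c (f : Fin n → ℤ) → sumFin n f * c ≡ sumFin n (λ i → f i * c)
*-distribʳ-sumFin n c f = begin
  sumFin n f * c              ≡⟨ cong (_* c) (sumFin≡sum n f) ⟩
  ℤΣ.sum f * c                ≡⟨ ℤΣ.*-distribʳ-sum c f ⟩
  ℤΣ.sum (λ i → f i * c)      ≡⟨ sumFin≡sum n _ ⟨
  sumFin n (λ i → f i * c)    ∎
  where open ≡-Reasoning

sumFin-*-sumFin : ∀ m n (f : Fin m → ℤ) (g : Fin n → ℤ) →
                  sumFin m f * sumFin n g ≡ sumFin m (λ i → sumFin n (λ j → f i * g j))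
sumFin-*-sumFin m n f g =
  trans (*-distribʳ-sumFin m (sumFin n g) f)
        (sumFin-cong m (λ i → *-distribˡ-sumFin n (f i) g))

sumFin-permute : ∀ n (f : Fin n → ℤ) (π : Fin n ↔ Fin n) →
                 sumFin n f ≡ sumFin n (f ∘ Inverse.to π)
sumFin-permute n f π = begin
  sumFin n f                  ≡⟨ sumFin≡sum n f ⟩
  ℤΣ.sum f                    ≡⟨ ℤΣ.sum-permute f π ⟩
  ℤΣ.sum (f ∘ Inverse.to π)   ≡⟨ sumFin≡sum n _ ⟨
  sumFin n (f ∘ Inverse.to π) ∎
  where open ≡-Reasoning

sumFin-pointSupported : ∀ n (f : Fin n → ℤ) j → (∀ i → i ≢ j → f i ≡ + 0) → sumFin n f ≡ f j
sumFin-pointSupported (suc n) f j f≡0 = begin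
  sumFin (suc n) f             ≡⟨ sumFin≡sum (suc n) f ⟩
  ℤΣ.sum f                     ≡⟨ ℤΣ.sum-remove f ⟩
  f j + ℤΣ.sum (removeAt f j)  ≡⟨ cong (_+_ (f j)) rest≡0 ⟩
  f j + + 0                    ≡⟨ ℤ.+-identityʳ (f j) ⟩
  f j                          ∎
  where
  open ≡-Reasoning
  rest≡0 : ℤΣ.sum (removeAt f j) ≡ + 0
  rest≡0 = trans (ℤΣ.sum-cong-≗ (λ i → f≡0 _ (punchInᵢ≢i j i)))
                 (ℤΣ.sum-replicate-zero n)

sumFin-const-1 : ∀ n → sumFin n (λ _ → + 1) ≡ + n
sumFin-const-1 zero    = refl
sumFin-const-1 (suc n) = cong (_+_ (+ 1)) (sumFin-const-1 n)

sumFin-splitAt : ∀ m n (f : Fin (m ℕ.+ n) → ℤ) →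
                 sumFin (m ℕ.+ n) f ≡ sumFin m (f ∘ (_↑ˡ n)) + sumFin n (f ∘ (m ↑ʳ_))
sumFin-splitAt zero    n f = sym (ℤ.+-identityˡ _)
sumFin-splitAt (suc m) n f =
  trans (cong (_+_ (f zero)) (sumFin-splitAt m n (f ∘ suc))) (sym (ℤ.+-assoc (f zero) _ _))

sumFin-combine : ∀ m n (f : Fin (m ℕ.* n) → ℤ) →
                 sumFin (m ℕ.* n) f ≡ sumFin m (λ i → sumFin n (λ j → f (combine i j)))
sumFin-combine zero    n f = refl
sumFin-combine (suc m) n f =
  trans (sumFin-splitAt n (m ℕ.* n) f)
        (cong (_+_ (sumFin n (f ∘ (_↑ˡ m ℕ.* n)))) (sumFin-combine m n (f ∘ (n ↑ʳ_))))

[m*n]/[o*p]≡[m/o]*[n/p] : ∀ {m n o p} .{{_ : NonZero o}} .{{_ : NonZero p}} .{{_ : NonZero (o ℕ.* p)}} →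
                          o ∣ m → p ∣ n →
                          (m ℕ.* n) / (o ℕ.* p) ≡ (m / o) ℕ.* (n / p)
[m*n]/[o*p]≡[m/o]*[n/p] {m} {n} {o} {p} o∣m p∣n = begin
  (m ℕ.* n) / (o ℕ.* p)
    ≡⟨ /-congˡ (cong₂ ℕ._*_ (m/n*n≡m o∣m) (m/n*n≡m p∣n)) ⟨
  ((m / o) ℕ.* o ℕ.* ((n / p) ℕ.* p)) / (o ℕ.* p)
    ≡⟨ /-congˡ (ℕ.[m*n]*[o*p]≡[m*o]*[n*p] (m / o) o (n / p) p) ⟩
  ((m / o) ℕ.* (n / p) ℕ.* (o ℕ.* p)) / (o ℕ.* p)
    ≡⟨ m*n/n≡m ((m / o) ℕ.* (n / p)) (o ℕ.* p) ⟩
  (m / o) ℕ.* (n / p)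
    ∎
  where open ≡-Reasoning

IsSignOrZero : ℤ → Set
IsSignOrZero a = (a ≡ + 0) ⊎ ((a ≡ + 1) ⊎ (a ≡ - (+ 1)))

nonzeroSign-square : ∀ {a} → IsSignOrZero a → a ≢ + 0 → a * a ≡ + 1
nonzeroSign-square (inj₁ a≡0)        a≢0 = contradiction a≡0 a≢0
nonzeroSign-square (inj₂ (inj₁ refl)) _  = refl
nonzeroSign-square (inj₂ (inj₂ refl)) _  = refl

*-isSignOrZero : ∀ {a b} → IsSignOrZero a → IsSignOrZero b → IsSignOrZero (a * b)
*-isSignOrZero (inj₁ refl)        _                  = inj₁ refl
*-isSignOrZero (inj₂ (inj₁ refl)) (inj₁ refl)        = inj₁ refl
*-isSignOrZero (inj₂ (inj₂ refl)) (inj₁ refl)        = inj₁ refl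
*-isSignOrZero (inj₂ (inj₁ refl)) (inj₂ (inj₁ refl)) = inj₂ (inj₁ refl)
*-isSignOrZero (inj₂ (inj₁ refl)) (inj₂ (inj₂ refl)) = inj₂ (inj₂ refl)
*-isSignOrZero (inj₂ (inj₂ refl)) (inj₂ (inj₁ refl)) = inj₂ (inj₂ refl)
*-isSignOrZero (inj₂ (inj₂ refl)) (inj₂ (inj₂ refl)) = inj₂ (inj₁ refl)

*-≢0 : ∀ {a b} → a ≢ + 0 → b ≢ + 0 → a * b ≢ + 0
*-≢0 {a} a≢0 b≢0 ab≡0 = [ a≢0 , b≢0 ]′ (ℤ.i*j≡0⇒i≡0∨j≡0 a ab≡0)

*-≢0⇒≢0 : ∀ a b → a * b ≢ + 0 → a ≢ + 0 × b ≢ + 0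
*-≢0⇒≢0 a b ab≢0 = (λ a≡0 → ab≢0 (cong (_* b) a≡0))
                 , (λ b≡0 → ab≢0 (trans (cong (a *_) b≡0) (ℤ.*-zeroʳ a)))

take-drop-injective : ∀ {A : Set} r {s} {u v : Vec A (r ℕ.+ s)} →
                      take r u ≡ take r v → drop r u ≡ drop r v → u ≡ v
take-drop-injective r {u = u} {v} take≡ drop≡ =
  trans (sym (take++drop≡id r u)) (trans (cong₂ _++_ take≡ drop≡) (take++drop≡id r v))

sumCube : ∀ m → (Vec Bool m → ℤ) → ℤ
sumCube zero    f = f []
sumCube (suc m) f = sumCube m (f ∘ (false ∷_)) + sumCube m (f ∘ (true ∷_))

sumCube-cong : ∀ m {f g : Vec Bool m → ℤ} → f ≗ g → sumCube m f ≡ sumCube m g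
sumCube-cong zero    f≗g = f≗g []
sumCube-cong (suc m) f≗g =
  cong₂ _+_ (sumCube-cong m (f≗g ∘ (false ∷_))) (sumCube-cong m (f≗g ∘ (true ∷_)))

sumCube-zero : ∀ m (f : Vec Bool m → ℤ) → (∀ u → f u ≡ + 0) → sumCube m f ≡ + 0
sumCube-zero zero    f f≡0 = f≡0 []
sumCube-zero (suc m) f f≡0 =
  cong₂ _+_ (sumCube-zero m _ (f≡0 ∘ (false ∷_))) (sumCube-zero m _ (f≡0 ∘ (true ∷_)))

sumCube-pointSupported : ∀ m (f : Vec Bool m → ℤ) u₀ → (∀ u → u ≢ u₀ → f u ≡ + 0) →
                         sumCube m f ≡ f u₀
sumCube-pointSupported zero    f []         f≡0 = refl
sumCube-pointSupported (suc m) f (false ∷ u₀) f≡0 =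
  trans (cong₂ _+_ (sumCube-pointSupported m _ u₀ (λ u u≢u₀ → f≡0 _ (u≢u₀ ∘ ∷-injectiveʳ)))
                   (sumCube-zero m _ (λ u → f≡0 _ λ ())))
        (ℤ.+-identityʳ _)
sumCube-pointSupported (suc m) f (true ∷ u₀) f≡0 =
  trans (cong₂ _+_ (sumCube-zero m _ (λ u → f≡0 _ λ ()))
                   (sumCube-pointSupported m _ u₀ (λ u u≢u₀ → f≡0 _ (u≢u₀ ∘ ∷-injectiveʳ))))
        (ℤ.+-identityˡ _)

sumCube-const : ∀ m c → sumCube m (λ _ → c) ≡ c * + (2 ^ m)
sumCube-const zero    c = sym (ℤ.*-identityʳ c)
sumCube-const (suc m) c = begin
  sumCube m (λ _ → c) + sumCube m (λ _ → c) ≡⟨ cong₂ _+_ (sumCube-const m c) (sumCube-const m c) ⟩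
  c * + (2 ^ m) + c * + (2 ^ m)             ≡⟨ ℤ.*-distribˡ-+ c (+ (2 ^ m)) (+ (2 ^ m)) ⟨
  c * + (2 ^ m ℕ.+ 2 ^ m)                   ≡⟨ cong (λ k → c * + (2 ^ m ℕ.+ k)) (ℕ.+-identityʳ (2 ^ m)) ⟨
  c * + (2 ^ suc m)                         ∎
  where open ≡-Reasoning

sumFin-sumCube-comm : ∀ n m (f : Fin n → Vec Bool m → ℤ) →
                      sumFin n (λ i → sumCube m (f i)) ≡ sumCube m (λ u → sumFin n (λ i → f i u))
sumFin-sumCube-comm n zero    f = refl
sumFin-sumCube-comm n (suc m) f =
  trans (sumFin-distrib-+ n _ _)
        (cong₂ _+_ (sumFin-sumCube-comm n m _) (sumFin-sumCube-comm n m _))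

signOf : Bool → ℤ
signOf b = if b then - (+ 1) else + 1

module GroupRingProperties (K : FinGroup) where
  open FinGroup K public
  open GroupRing K public
  open Elementary K public
  open IsGroup isGroup public using (identityˡ; identityʳ; inverseʳ)

  group : Group 0ℓ 0ℓ
  group = record { isGroup = isGroup }

  open GroupProperties group using (ε⁻¹≈ε; //-rightDividesˡ; //-rightDividesʳ)

  from : Carrier → Fin order
  from = Inverse.from enum

  elt-from : ∀ g → elt (from g) ≡ g
  elt-from = Inverse.strictlyInverseˡ enum

  from-elt : ∀ i → from (elt i) ≡ i
  from-elt = Inverse.strictlyInverseʳ enum

  from-injective : ∀ {g h} → from g ≡ from h → g ≡ h
  from-injective {g} {h} eq = trans (sym (elt-from g)) (trans (cong elt eq) (elt-from h))

  _≟_ : DecidableEquality Carrier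
  g ≟ h = map′ from-injective (cong from) (from g ≟ᶠ from h)

  δ-diagonal : ∀ g → δ g g ≡ + 1
  δ-diagonal g rewrite dec-true (g ≟ g) refl = refl

  δ-offDiagonal : ∀ {g h} → g ≢ h → δ g h ≡ + 0
  δ-offDiagonal {g} {h} g≢h rewrite dec-false (g ≟ h) g≢h = refl

  sumK : ℤK → ℤ
  sumK f = sumFin order (f ∘ elt)

  sumK-pointSupported : ∀ (f : ℤK) g → (∀ h → h ≢ g → f h ≡ + 0) → sumK f ≡ f g
  sumK-pointSupported f g f≡0 =
    trans (sumFin-pointSupported order (f ∘ elt) (from g) (λ i i≢from-g → f≡0 (elt i) (i≢from-g ∘ from-≡ i)))
          (cong f (elt-from g))
    where
    from-≡ : ∀ i → elt i ≡ g → i ≡ from g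
    from-≡ i eq = trans (sym (from-elt i)) (cong from eq)

  rightTranslation : Carrier → Fin order ↔ Fin order
  rightTranslation a = mk↔ₛ′ (λ i → from (elt i ∙ a)) (λ i → from (elt i ∙ a ⁻¹))
    (λ i → trans (cong (λ g → from (g ∙ a)) (elt-from _))
                 (trans (cong from (//-rightDividesˡ a (elt i))) (from-elt i)))
    (λ i → trans (cong (λ g → from (g ∙ a ⁻¹)) (elt-from _))
                 (trans (cong from (//-rightDividesʳ a (elt i))) (from-elt i)))

  sumK-translateʳ : ∀ (f : ℤK) a → sumK (λ g → f (g ∙ a)) ≡ sumK f
  sumK-translateʳ f a = begin
    sumFin order (λ i → f (elt i ∙ a))               ≡⟨ sumFin-cong order (λ i → cong f (elt-from _)) ⟨
    sumFin order (λ i → f (elt (from (elt i ∙ a))))  ≡⟨ sumFin-permute order (f ∘ elt) (rightTranslation a) ⟨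
    sumFin order (f ∘ elt)                           ∎
    where open ≡-Reasoning

  ⊛-cong : ∀ {f f′ h h′ : ℤK} → f ≗ f′ → h ≗ h′ → f ⊛ h ≗ f′ ⊛ h′
  ⊛-cong f≗f′ h≗h′ g = sumFin-cong order (λ i → cong₂ _*_ (f≗f′ (elt i)) (h≗h′ _))

  δε-⊛ : ∀ f → δ ε ⊛ f ≗ f
  δε-⊛ f g = begin
    (δ ε ⊛ f) g             ≡⟨ sumK-pointSupported _ ε (λ h h≢ε → cong (_* f (h ⁻¹ ∙ g)) (δ-offDiagonal (h≢ε ∘ sym))) ⟩
    δ ε ε * f (ε ⁻¹ ∙ g)    ≡⟨ cong₂ _*_ (δ-diagonal ε) (cong f (trans (cong (_∙ g) ε⁻¹≈ε) (identityˡ g))) ⟩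
    + 1 * f g               ≡⟨ ℤ.*-identityˡ (f g) ⟩
    f g                     ∎
    where open ≡-Reasoning

  eE-cong : ∀ {m} {x x′ : Fin m → Carrier} → x ≗ x′ → ∀ u → eE x u ≡ eE x′ u
  eE-cong x≗x′ []      = refl
  eE-cong x≗x′ (b ∷ u) = cong₂ _∙_ (cong (λ g → if b then g else ε) (x≗x′ zero)) (eE-cong (x≗x′ ∘ suc) u)

  χ-cong : ∀ {m} {x x′ : Fin m → Carrier} → x ≗ x′ → ∀ u → χ x u ≗ χ x′ u
  χ-cong x≗x′ []      = λ _ → refl
  χ-cong x≗x′ (b ∷ u) =
    ⊛-cong (λ g → cong (λ z → (δ ε ⊕ (signOf b · δ z)) g) (x≗x′ zero))
           (χ-cong (x≗x′ ∘ suc) u)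

  conjugate-ε : ∀ g → (g ∙ ε) ∙ g ⁻¹ ≡ ε
  conjugate-ε g = trans (cong (_∙ g ⁻¹) (identityʳ g)) (inverseʳ g)

  eE-replicate-false : ∀ {m} (x : Fin m → Carrier) → eE x (replicate m false) ≡ ε
  eE-replicate-false {zero}  x = refl
  eE-replicate-false {suc m} x = trans (identityˡ _) (eE-replicate-false (x ∘ suc))

  sumCube-coset[A²]≡1 : ∀ {m} {x : Fin m → Carrier} {A : ℤK} → IsCosetTransversalSign x A →
                 ∀ g → sumCube m (λ u → A (g ∙ eE x u) * A (g ∙ eE x u)) ≡ + 1
  sumCube-coset[A²]≡1 {m} {x} {A} (sign , cover , unique) g =
    trans (sumCube-pointSupported m _ u₀ outside) (nonzeroSign-square (sign _) Au₀≢0)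
    where
    u₀ = proj₁ (cover g)
    Au₀≢0 = proj₂ (cover g)
    outside : ∀ u → u ≢ u₀ → A (g ∙ eE x u) * A (g ∙ eE x u) ≡ + 0
    outside u u≢u₀ with A (g ∙ eE x u) ℤ.≟ + 0
    ... | yes Au≡0 = cong (λ a → a * a) Au≡0
    ... | no  Au≢0 = contradiction (unique g u u₀ Au≢0 Au₀≢0) u≢u₀

  order≡sumK[A²]*2^m : ∀ {m} {x : Fin m → Carrier} {A : ℤK} → IsCosetTransversalSign x A →
                      + order ≡ sumK (λ g → A g * A g) * + (2 ^ m)
  order≡sumK[A²]*2^m {m} {x} {A} transversal = begin
    + order                                              ≡⟨ sumFin-const-1 order ⟨
    sumK (λ _ → + 1)                                     ≡⟨ sumFin-cong order (sumCube-coset[A²]≡1 transversal ∘ elt) ⟨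
    sumK (λ g → sumCube m (λ u → S (g ∙ eE x u)))        ≡⟨ sumFin-sumCube-comm order m _ ⟩
    sumCube m (λ u → sumK (λ g → S (g ∙ eE x u)))        ≡⟨ sumCube-cong m (λ u → sumK-translateʳ S (eE x u)) ⟩
    sumCube m (λ _ → sumK S)                             ≡⟨ sumCube-const m (sumK S) ⟩
    sumK S * + (2 ^ m)                                   ∎
    where
    open ≡-Reasoning
    S : ℤK
    S g = A g * A g

  2^m∣order : ∀ {m} {x : Fin m → Carrier} {A : ℤK} → IsCosetTransversalSign x A → 2 ^ m ∣ order
  2^m∣order {m} {A = A} transversal = divides ℤ.∣ ∑A² ∣ (begin
    order                    ≡⟨ cong ℤ.∣_∣ (order≡sumK[A²]*2^m transversal) ⟩
    ℤ.∣ ∑A² * + (2 ^ m) ∣    ≡⟨ ℤ.abs-* ∑A² (+ (2 ^ m)) ⟩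
    ℤ.∣ ∑A² ∣ ℕ.* 2 ^ m      ∎)
    where
    open ≡-Reasoning
    ∑A² = sumK (λ g → A g * A g)

module DirectProduct (K L : FinGroup) where
  private
    module K = GroupRingProperties K
    module L = GroupRingProperties L
    module P = GroupRingProperties (K ×ᴳ L)

  _⊗_ : K.ℤK → L.ℤK → P.ℤK
  (f ⊗ h) g = f (proj₁ g) * h (proj₂ g)

  elt-combine : ∀ i j → P.elt (combine i j) ≡ (K.elt i , L.elt j)
  elt-combine i j = cong (λ ij → K.elt (proj₁ ij) , L.elt (proj₂ ij)) (remQuot-combine i j)

  ⊛-⊗ : ∀ f₁ f₂ h₁ h₂ → (f₁ ⊗ f₂) P.⊛ (h₁ ⊗ h₂) ≗ (f₁ K.⊛ h₁) ⊗ (f₂ L.⊛ h₂)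
  ⊛-⊗ f₁ f₂ h₁ h₂ g = begin
    sumFin (K.order ℕ.* L.order) (term ∘ P.elt)
      ≡⟨ sumFin-combine K.order L.order (term ∘ P.elt) ⟩
    sumFin K.order (λ i → sumFin L.order (λ j → term (P.elt (combine i j))))
      ≡⟨ sumFin-cong K.order (λ i → sumFin-cong L.order (λ j → factorise i j)) ⟩
    sumFin K.order (λ i → sumFin L.order (λ j → term₁ i * term₂ j))
      ≡⟨ sumFin-*-sumFin K.order L.order term₁ term₂ ⟨
    sumFin K.order term₁ * sumFin L.order term₂
      ∎
    where
    open ≡-Reasoning
    term : P.Carrier → ℤ
    term k = (f₁ ⊗ f₂) k * (h₁ ⊗ h₂) (k P.⁻¹ P.∙ g)
    term₁ : Fin K.order → ℤ
    term₁ i = f₁ (K.elt i) * h₁ (K.elt i K.⁻¹ K.∙ proj₁ g)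
    term₂ : Fin L.order → ℤ
    term₂ j = f₂ (L.elt j) * h₂ (L.elt j L.⁻¹ L.∙ proj₂ g)
    factorise : ∀ i j → term (P.elt (combine i j)) ≡ term₁ i * term₂ j
    factorise i j = trans (cong term (elt-combine i j)) (interchange (f₁ (K.elt i)) (f₂ (L.elt j)) _ _)

  δ-pair : ∀ a₁ a₂ → P.δ (a₁ , a₂) ≗ K.δ a₁ ⊗ L.δ a₂
  δ-pair a₁ a₂ (c₁ , c₂) with a₁ K.≟ c₁ | a₂ L.≟ c₂
  ... | yes refl | yes refl =
    trans (P.δ-diagonal (a₁ , a₂)) (sym (cong₂ _*_ (K.δ-diagonal a₁) (L.δ-diagonal a₂)))
  ... | yes refl | no a₂≢c₂ =
    trans (P.δ-offDiagonal (a₂≢c₂ ∘ cong proj₂))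
          (sym (trans (cong (K.δ a₁ a₁ *_) (L.δ-offDiagonal a₂≢c₂)) (ℤ.*-zeroʳ (K.δ a₁ a₁))))
  ... | no a₁≢c₁ | _ =
    trans (P.δ-offDiagonal (a₁≢c₁ ∘ cong proj₁)) (sym (cong (_* L.δ a₂ c₂) (K.δ-offDiagonal a₁≢c₁)))

  index-× : ∀ {r s} → 2 ^ r ∣ K.order → 2 ^ s ∣ L.order →
            P.index (r ℕ.+ s) ≡ K.index r ℕ.* L.index s
  index-× {r} {s} 2^r∣ 2^s∣ =
    trans (/-congʳ (ℕ.^-distribˡ-+-* 2 r s)) ([m*n]/[o*p]≡[m/o]*[n/p] 2^r∣ 2^s∣)
    where
    instance
      2^r≢0   = ℕ.m^n≢0 2 r
      2^s≢0   = ℕ.m^n≢0 2 s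
      2^r+s≢0 = ℕ.m^n≢0 2 (r ℕ.+ s)
      2^r*2^s≢0 = ℕ.m*n≢0 (2 ^ r) (2 ^ s)

  prodGens-suc : ∀ {r s} (x : Fin (suc r) → K.Carrier) (y : Fin s → L.Carrier) →
                 prodGens K L x y ∘ suc ≗ prodGens K L (x ∘ suc) y
  prodGens-suc {r} x y i with Fin.splitAt r i
  ... | inj₁ _ = refl
  ... | inj₂ _ = refl

  eE-inj₂ : ∀ {s} (y : Fin s → L.Carrier) v → P.eE (λ j → K.ε , y j) v ≡ (K.ε , L.eE y v)
  eE-inj₂ y []          = refl
  eE-inj₂ y (true ∷ v)  rewrite eE-inj₂ (y ∘ suc) v = cong (_, _) (K.identityˡ K.ε)
  eE-inj₂ y (false ∷ v) rewrite eE-inj₂ (y ∘ suc) v = cong (_, _) (K.identityˡ K.ε)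

  eE-prodGens-++ : ∀ {r s} (x : Fin r → K.Carrier) (y : Fin s → L.Carrier) u v →
                   P.eE (prodGens K L x y) (u ++ v) ≡ (K.eE x u , L.eE y v)
  eE-prodGens-++ x y []      v = eE-inj₂ y v
  eE-prodGens-++ x y (true ∷ u) v
    rewrite P.eE-cong (prodGens-suc x y) (u ++ v) | eE-prodGens-++ (x ∘ suc) y u v =
    cong (_ ,_) (L.identityˡ _)
  eE-prodGens-++ x y (false ∷ u) v
    rewrite P.eE-cong (prodGens-suc x y) (u ++ v) | eE-prodGens-++ (x ∘ suc) y u v =
    cong (_ ,_) (L.identityˡ _)

  eE-prodGens : ∀ {r s} (x : Fin r → K.Carrier) (y : Fin s → L.Carrier) w →
                P.eE (prodGens K L x y) w ≡ (K.eE x (take r w) , L.eE y (drop r w))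
  eE-prodGens {r} x y w =
    trans (cong (P.eE (prodGens K L x y)) (sym (take++drop≡id r w))) (eE-prodGens-++ x y (take r w) (drop r w))

  χFactor-inj₁ : ∀ c g → P.δ P.ε P.⊕ (c P.· P.δ (g , L.ε)) ≗ (K.δ K.ε K.⊕ (c K.· K.δ g)) ⊗ L.δ L.ε
  χFactor-inj₁ c g (k₁ , k₂) =
    trans (cong₂ _+_ (δ-pair K.ε L.ε (k₁ , k₂)) (cong (c *_) (δ-pair g L.ε (k₁ , k₂))))
          (solve 4 (λ a b c d → a :* b :+ c :* (d :* b) := (a :+ c :* d) :* b) refl
                   (K.δ K.ε k₁) (L.δ L.ε k₂) c (K.δ g k₁))

  χFactor-inj₂ : ∀ c h → P.δ P.ε P.⊕ (c P.· P.δ (K.ε , h)) ≗ K.δ K.ε ⊗ (L.δ L.ε L.⊕ (c L.· L.δ h))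
  χFactor-inj₂ c h (k₁ , k₂) =
    trans (cong₂ _+_ (δ-pair K.ε L.ε (k₁ , k₂)) (cong (c *_) (δ-pair K.ε h (k₁ , k₂))))
          (solve 4 (λ a b c d → a :* b :+ c :* (a :* d) := a :* (b :+ c :* d)) refl
                   (K.δ K.ε k₁) (L.δ L.ε k₂) c (L.δ h k₂))

  χ-inj₂ : ∀ {s} (y : Fin s → L.Carrier) v → P.χ (λ j → K.ε , y j) v ≗ K.δ K.ε ⊗ L.χ y v
  χ-inj₂ y []      = δ-pair K.ε L.ε
  χ-inj₂ y (b ∷ v) k = begin
    P.χ (λ j → K.ε , y j) (b ∷ v) k
      ≡⟨ P.⊛-cong (χFactor-inj₂ (signOf b) (y zero)) (χ-inj₂ (y ∘ suc) v) k ⟩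
    ((K.δ K.ε ⊗ factor) P.⊛ (K.δ K.ε ⊗ L.χ (y ∘ suc) v)) k
      ≡⟨ ⊛-⊗ (K.δ K.ε) factor (K.δ K.ε) (L.χ (y ∘ suc) v) k ⟩
    (K.δ K.ε K.⊛ K.δ K.ε) (proj₁ k) * L.χ y (b ∷ v) (proj₂ k)
      ≡⟨ cong (_* L.χ y (b ∷ v) (proj₂ k)) (K.δε-⊛ (K.δ K.ε) (proj₁ k)) ⟩
    (K.δ K.ε ⊗ L.χ y (b ∷ v)) k
      ∎
    where
    open ≡-Reasoning
    factor = L.δ L.ε L.⊕ (signOf b L.· L.δ (y zero))

  χ-prodGens-++ : ∀ {r s} (x : Fin r → K.Carrier) (y : Fin s → L.Carrier) u v →
                  P.χ (prodGens K L x y) (u ++ v) ≗ K.χ x u ⊗ L.χ y v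
  χ-prodGens-++ x y []      v = χ-inj₂ y v
  χ-prodGens-++ x y (b ∷ u) v k = begin
    P.χ (prodGens K L x y) (b ∷ u ++ v) k
      ≡⟨ P.⊛-cong (χFactor-inj₁ (signOf b) (x zero)) rest k ⟩
    ((factor ⊗ L.δ L.ε) P.⊛ (K.χ (x ∘ suc) u ⊗ L.χ y v)) k
      ≡⟨ ⊛-⊗ factor (L.δ L.ε) (K.χ (x ∘ suc) u) (L.χ y v) k ⟩
    K.χ x (b ∷ u) (proj₁ k) * (L.δ L.ε L.⊛ L.χ y v) (proj₂ k)
      ≡⟨ cong (K.χ x (b ∷ u) (proj₁ k) *_) (L.δε-⊛ (L.χ y v) (proj₂ k)) ⟩
    (K.χ x (b ∷ u) ⊗ L.χ y v) k
      ∎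
    where
    open ≡-Reasoning
    factor = K.δ K.ε K.⊕ (signOf b K.· K.δ (x zero))
    rest : P.χ (prodGens K L x y ∘ suc) (u ++ v) ≗ K.χ (x ∘ suc) u ⊗ L.χ y v
    rest k′ = trans (P.χ-cong (prodGens-suc x y) (u ++ v) k′) (χ-prodGens-++ (x ∘ suc) y u v k′)

  module _ {r s} {x : Fin r → K.Carrier} {y : Fin s → L.Carrier} where

    ⊗-isElemAbNormal : K.IsElemAbNormal x → L.IsElemAbNormal y → P.IsElemAbNormal (prodGens K L x y)
    ⊗-isElemAbNormal Ex Ey = record { sq-id = sq-id ; comm = comm ; indep = indep ; normal = normal }
      where
      module Ex = K.IsElemAbNormal Ex
      module Ey = L.IsElemAbNormal Ey
      z = prodGens K L x y

      sq-id : ∀ i → z i P.∙ z i ≡ P.ε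
      sq-id i with Fin.splitAt r i
      ... | inj₁ j = cong₂ _,_ (Ex.sq-id j) (L.identityˡ L.ε)
      ... | inj₂ j = cong₂ _,_ (K.identityˡ K.ε) (Ey.sq-id j)

      comm : ∀ i j → z i P.∙ z j ≡ z j P.∙ z i
      comm i j with Fin.splitAt r i | Fin.splitAt r j
      ... | inj₁ a | inj₁ b = cong (_, _) (Ex.comm a b)
      ... | inj₁ a | inj₂ b = cong₂ _,_ (trans (K.identityʳ _) (sym (K.identityˡ _)))
                                        (trans (L.identityˡ _) (sym (L.identityʳ _)))
      ... | inj₂ a | inj₁ b = cong₂ _,_ (trans (K.identityˡ _) (sym (K.identityʳ _)))
                                        (trans (L.identityʳ _) (sym (L.identityˡ _)))
      ... | inj₂ a | inj₂ b = cong (_ ,_) (Ey.comm a b)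

      indep : ∀ u v → P.eE z u ≡ P.eE z v → u ≡ v
      indep u v eq = take-drop-injective r (Ex.indep _ _ (cong proj₁ eq′)) (Ey.indep _ _ (cong proj₂ eq′))
        where eq′ = trans (sym (eE-prodGens x y u)) (trans eq (eE-prodGens x y v))

      normal : ∀ g i → ∃ λ w → (g P.∙ z i) P.∙ (g P.⁻¹) ≡ P.eE z w
      normal (g₁ , g₂) i with Fin.splitAt r i
      ... | inj₁ j = let (u , conj≡eu) = Ex.normal g₁ j in
        u ++ replicate s false ,
        trans (cong₂ _,_ conj≡eu (trans (L.conjugate-ε g₂) (sym (L.eE-replicate-false y))))
              (sym (eE-prodGens-++ x y u (replicate s false)))
      ... | inj₂ j = let (v , conj≡ev) = Ey.normal g₂ j in
        replicate r false ++ v ,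
        trans (cong₂ _,_ (trans (K.conjugate-ε g₁) (sym (K.eE-replicate-false x))) conj≡ev)
              (sym (eE-prodGens-++ x y (replicate r false) v))

    ⊗-isCosetTransversalSign : ∀ {A B} → K.IsCosetTransversalSign x A → L.IsCosetTransversalSign y B →
                               P.IsCosetTransversalSign (prodGens K L x y) (A ⊗ B)
    ⊗-isCosetTransversalSign {A} {B} (signA , coverA , uniqueA) (signB , coverB , uniqueB) =
      sign , cover , unique
      where
      z = prodGens K L x y

      sign : ∀ g → IsSignOrZero ((A ⊗ B) g)
      sign (g₁ , g₂) = *-isSignOrZero (signA g₁) (signB g₂)

      cover : ∀ g → Σ (Vec Bool (r ℕ.+ s)) λ w → (A ⊗ B) (g P.∙ P.eE z w) ≢ + 0
      cover (g₁ , g₂) =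
        let (u , Au≢0) = coverA g₁
            (v , Bv≢0) = coverB g₂
        in u ++ v , subst (λ e → (A ⊗ B) ((g₁ , g₂) P.∙ e) ≢ + 0) (sym (eE-prodGens-++ x y u v))
                          (*-≢0 Au≢0 Bv≢0)

      factors : ∀ g w → (A ⊗ B) (g P.∙ P.eE z w) ≢ + 0 →
                A (proj₁ g K.∙ K.eE x (take r w)) ≢ + 0 × B (proj₂ g L.∙ L.eE y (drop r w)) ≢ + 0
      factors g w ABw≢0 =
        *-≢0⇒≢0 (A (proj₁ g K.∙ K.eE x (take r w))) (B (proj₂ g L.∙ L.eE y (drop r w)))
                (subst (λ e → (A ⊗ B) (g P.∙ e) ≢ + 0) (eE-prodGens x y w) ABw≢0)

      unique : ∀ g w₁ w₂ → (A ⊗ B) (g P.∙ P.eE z w₁) ≢ + 0 → (A ⊗ B) (g P.∙ P.eE z w₂) ≢ + 0 → w₁ ≡ w₂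
      unique g w₁ w₂ ABw₁≢0 ABw₂≢0 =
        take-drop-injective r (uniqueA (proj₁ g) (take r w₁) (take r w₂) (proj₁ AB₁) (proj₁ AB₂))
                              (uniqueB (proj₂ g) (drop r w₁) (drop r w₂) (proj₂ AB₁) (proj₂ AB₂))
        where
        AB₁ = factors g w₁ ABw₁≢0
        AB₂ = factors g w₂ ABw₂≢0

    ⊗-isSignatureBlock : ∀ {u v A B} → K.IsSignatureBlock x u A → L.IsSignatureBlock y v B →
                         P.IsSignatureBlock (prodGens K L x y) (u ++ v) (A ⊗ B)
    ⊗-isSignatureBlock {u} {v} {A} {B} (transversalA , equationA) (transversalB , equationB) =
      ⊗-isCosetTransversalSign transversalA transversalB , equation
      where
      χ = P.χ (prodGens K L x y) (u ++ v)
      equation : ∀ g → (((A ⊗ B) P.⊛ χ) P.⊛ P.inv⁽⁻¹⁾ (A ⊗ B)) g ≡ ((+ P.index (r ℕ.+ s)) P.· χ) g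
      equation g = begin
        (((A ⊗ B) P.⊛ χ) P.⊛ P.inv⁽⁻¹⁾ (A ⊗ B)) g
          ≡⟨ P.⊛-cong {h = P.inv⁽⁻¹⁾ (A ⊗ B)} A⊗B⊛χ-factorises (λ _ → refl) g ⟩
        (((A K.⊛ K.χ x u) ⊗ (B L.⊛ L.χ y v)) P.⊛ (K.inv⁽⁻¹⁾ A ⊗ L.inv⁽⁻¹⁾ B)) g
          ≡⟨ ⊛-⊗ (A K.⊛ K.χ x u) (B L.⊛ L.χ y v) (K.inv⁽⁻¹⁾ A) (L.inv⁽⁻¹⁾ B) g ⟩
        ((A K.⊛ K.χ x u) K.⊛ K.inv⁽⁻¹⁾ A) (proj₁ g) * ((B L.⊛ L.χ y v) L.⊛ L.inv⁽⁻¹⁾ B) (proj₂ g)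
          ≡⟨ cong₂ _*_ (equationA (proj₁ g)) (equationB (proj₂ g)) ⟩
        (+ K.index r * K.χ x u (proj₁ g)) * (+ L.index s * L.χ y v (proj₂ g))
          ≡⟨ interchange (+ K.index r) (K.χ x u (proj₁ g)) (+ L.index s) (L.χ y v (proj₂ g)) ⟩
        (+ K.index r * + L.index s) * (K.χ x u ⊗ L.χ y v) g
          ≡⟨ cong₂ _*_ (trans (sym (ℤ.pos-* (K.index r) (L.index s))) (cong +_ (sym index≡)))
                       (sym (χ-prodGens-++ x y u v g)) ⟩
        ((+ P.index (r ℕ.+ s)) P.· χ) g
          ∎
        where
        open ≡-Reasoning
        index≡ : P.index (r ℕ.+ s) ≡ K.index r ℕ.* L.index s
        index≡ = index-× {r} {s} (K.2^m∣order transversalA) (L.2^m∣order transversalB)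
        A⊗B⊛χ-factorises : (A ⊗ B) P.⊛ χ ≗ (A K.⊛ K.χ x u) ⊗ (B L.⊛ L.χ y v)
        A⊗B⊛χ-factorises k = trans (P.⊛-cong {f = A ⊗ B} (λ _ → refl) (χ-prodGens-++ x y u v) k)
                          (⊛-⊗ A B (K.χ x u) (L.χ y v) k)

    ⊗-signatureSet : K.SignatureSet x → L.SignatureSet y → P.SignatureSet (prodGens K L x y)
    ⊗-signatureSet (A , blockA) (B , blockB) =
      (λ w → A (take r w) ⊗ B (drop r w)) ,
      (λ w → subst (λ w′ → P.IsSignatureBlock (prodGens K L x y) w′ (A (take r w) ⊗ B (drop r w)))
                   (take++drop≡id r w)
                   (⊗-isSignatureBlock {take r w} {drop r w} (blockA (take r w)) (blockB (drop r w))))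

proposition2p5 : (Kr Ks : FinGroup) (r s : ℕ)
    → (x : Fin r → FinGroup.Carrier Kr) (y : Fin s → FinGroup.Carrier Ks)
    → Elementary.IsElemAbNormal Kr x
    → Elementary.IsElemAbNormal Ks y
    → Elementary.SignatureSet Kr x
    → Elementary.SignatureSet Ks y
    → Elementary.IsElemAbNormal (Kr ×ᴳ Ks) (prodGens Kr Ks x y)
    × Elementary.SignatureSet (Kr ×ᴳ Ks) (prodGens Kr Ks x y)
proposition2p5 Kr Ks r s x y Ex Ey Sx Sy = ⊗-isElemAbNormal Ex Ey , ⊗-signatureSet Sx Sy
  where open DirectProduct Kr Ks
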